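{- Let $A,B,C$ be normal subgroups of a group $G$ with $B\subseteq A$, and let $A'$ be the commutator subgroup of $A$. Then: (1) the map $a(B\cap C)\mapsto a(B\cap C)A'$ ($a\in A\cap C$) gives a short exact sequence $1\to (B\cap C)(C\cap A')/(B\cap C)\to (A\cap C)/(B\cap C)\to (A\cap C)A'/(B\cap C)A'\to 1$; (2) the map $f_2:(A\cap C)/(B\cap C)\to A/B$, $a(B\cap C)\mapsto aB$, is an injective homomorphism whose restriction $f_1$ to $(B\cap C)(C\cap A')/(B\cap C)$ is an injective map into $BA'/B$, and together with the induced map on the right-hand terms these form a commutative diagram from the sequence in (1) to the canonical short exact sequence $1\to BA'/B\to A/B\to A/BA'\to1$; (3) if $f_2$ is an isomorphism, then this diagram is an isomorphism of short exact sequences, and in particular the natural map $(A\cap C)A'/(B\cap C)A'\to A/BA'$ is an isomorphism. -}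

module Defs where

open import Level using (Level; _⊔_)
open import Data.Product using (Σ; ∃; _×_; _,_; proj₁; proj₂; ∃-syntax)
open import Relation.Unary using (Pred; _⊆_; _∩_)
open import Algebra.Bundles using (Group; RawGroup)
open import Algebra.Morphism.Structures using (module GroupMorphisms)
open import Function.Definitions using (Injective; Surjective)
import Relation.Binary.Reasoning.Setoid as SetoidReasoning
import Algebra.Properties.Group as GroupProps

module _ {a b q ℓa ℓb ℓq : Level} where

  record ShortExact (N : RawGroup a ℓa) (M : RawGroup b ℓb) (Q : RawGroup q ℓq)
                    (ι : RawGroup.Carrier N → RawGroup.Carrier M)
                    (π : RawGroup.Carrier M → RawGroup.Carrier Q)
                    : Set (a ⊔ b ⊔ q ⊔ ℓa ⊔ ℓb ⊔ ℓq) where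
    open RawGroup N using () renaming (_≈_ to _≈N_)
    open RawGroup M using () renaming (_≈_ to _≈M_)
    open RawGroup Q using () renaming (_≈_ to _≈Q_; ε to εQ)
    field
      ι-hom       : GroupMorphisms.IsGroupHomomorphism N M ι
      π-hom       : GroupMorphisms.IsGroupHomomorphism M Q π
      ι-injective : Injective _≈N_ _≈M_ ι
      π-surjective : Surjective _≈M_ _≈Q_ π
      im⊆ker      : ∀ n → π (ι n) ≈Q εQ
      ker⊆im      : ∀ m → π m ≈Q εQ → ∃[ n ] ι n ≈M m

-- commutativity of a square   X --f--> Y
--                              |g       |h
--                              v        v
--                              Z --k--> W
Commutes : ∀ {x y z w ℓw} {X : Set x} {Y : Set y} {Z : Set z} (W : RawGroup w ℓw) →
           (X → Y) → (X → Z) → (Y → RawGroup.Carrier W) → (Z → RawGroup.Carrier W) →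
           Set (x ⊔ ℓw)
Commutes W f g h k = ∀ x → RawGroup._≈_ W (h (f x)) (k (g x))

module GroupTheory {c ℓ} (G : Group c ℓ) where
  open Group G
  open GroupProps G
  open SetoidReasoning setoid

  Subset : Set _
  Subset = Pred Carrier (c ⊔ ℓ)

  record IsSubgroup (H : Subset) : Set (c ⊔ ℓ) where
    field
      resp : ∀ {x y} → x ≈ y → H x → H y
      ε∈   : H ε
      ∙∈   : ∀ {x y} → H x → H y → H (x ∙ y)
      ⁻¹∈  : ∀ {x} → H x → H (x ⁻¹)

  conj : Carrier → Carrier → Carrier
  conj g x = g ∙ x ∙ g ⁻¹

  record IsNormalSubgroup (H : Subset) : Set (c ⊔ ℓ) where
    field
      isSubgroup : IsSubgroup H
      conj∈      : ∀ g {x} → H x → H (conj g x)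
    open IsSubgroup isSubgroup public

  [_,_] : Carrier → Carrier → Carrier
  [ x , y ] = x ⁻¹ ∙ y ⁻¹ ∙ x ∙ y

  data Commutator (H : Subset) : Subset where
    gen : ∀ {z} x y → H x → H y → z ≈ [ x , y ] → Commutator H z
    one : ∀ {z} → z ≈ ε → Commutator H z
    mul : ∀ {z} x y → Commutator H x → Commutator H y → z ≈ x ∙ y → Commutator H z
    inv : ∀ {z} x → Commutator H x → z ≈ x ⁻¹ → Commutator H z

  _·_ : Subset → Subset → Subset
  (H · K) g = ∃[ h ] ∃[ k ] (H h × K k × g ≈ h ∙ k)

  -- the quotient H/K (for a subgroup H and a subgroup K normal in H):
  -- elements are elements of H, with x ≈ y iff x⁻¹ y ∈ K (i.e. xK = yK)
  Quot : (H : Subset) → IsSubgroup H → Subset → RawGroup (c ⊔ ℓ) (c ⊔ ℓ)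
  Quot H sH K = record
    { Carrier = Σ Carrier H
    ; _≈_     = λ x y → K (proj₁ x ⁻¹ ∙ proj₁ y)
    ; _∙_     = λ x y → proj₁ x ∙ proj₁ y , IsSubgroup.∙∈ sH (proj₂ x) (proj₂ y)
    ; ε       = ε , IsSubgroup.ε∈ sH
    ; _⁻¹     = λ x → proj₁ x ⁻¹ , IsSubgroup.⁻¹∈ sH (proj₂ x)
    }

  private
    cancelˡ : ∀ a b → a ∙ (a ⁻¹ ∙ b) ≈ b
    cancelˡ a b = begin
      a ∙ (a ⁻¹ ∙ b)  ≈⟨ sym (assoc _ _ _) ⟩
      a ∙ a ⁻¹ ∙ b    ≈⟨ ∙-cong (inverseʳ a) refl ⟩
      ε ∙ b           ≈⟨ identityˡ b ⟩
      b ∎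

    cancelˡ' : ∀ a b → a ⁻¹ ∙ (a ∙ b) ≈ b
    cancelˡ' a b = begin
      a ⁻¹ ∙ (a ∙ b)  ≈⟨ sym (assoc _ _ _) ⟩
      a ⁻¹ ∙ a ∙ b    ≈⟨ ∙-cong (inverseˡ a) refl ⟩
      ε ∙ b           ≈⟨ identityˡ b ⟩
      b ∎

    midcancel : ∀ a g b → (a ∙ g ⁻¹) ∙ (g ∙ b) ≈ a ∙ b
    midcancel a g b = begin
      (a ∙ g ⁻¹) ∙ (g ∙ b)  ≈⟨ assoc _ _ _ ⟩
      a ∙ (g ⁻¹ ∙ (g ∙ b))  ≈⟨ ∙-cong refl (cancelˡ' g b) ⟩
      a ∙ b ∎

    conj-cong : ∀ g {x y} → x ≈ y → conj g x ≈ conj g y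
    conj-cong g eq = ∙-cong (∙-cong refl eq) refl

    conj-∙ : ∀ g x y → conj g (x ∙ y) ≈ conj g x ∙ conj g y
    conj-∙ g x y = begin
      g ∙ (x ∙ y) ∙ g ⁻¹                 ≈⟨ ∙-cong (sym (assoc _ _ _)) refl ⟩
      g ∙ x ∙ y ∙ g ⁻¹                   ≈⟨ ∙-cong (sym (midcancel (g ∙ x) g y)) refl ⟩
      (g ∙ x ∙ g ⁻¹) ∙ (g ∙ y) ∙ g ⁻¹    ≈⟨ assoc _ _ _ ⟩
      (g ∙ x ∙ g ⁻¹) ∙ (g ∙ y ∙ g ⁻¹) ∎

    conj-⁻¹ : ∀ g x → conj g (x ⁻¹) ≈ (conj g x) ⁻¹
    conj-⁻¹ g x = sym (begin
      (g ∙ x ∙ g ⁻¹) ⁻¹          ≈⟨ ⁻¹-anti-homo-∙ _ _ ⟩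
      g ⁻¹ ⁻¹ ∙ (g ∙ x) ⁻¹       ≈⟨ ∙-cong (⁻¹-involutive g) (⁻¹-anti-homo-∙ g x) ⟩
      g ∙ (x ⁻¹ ∙ g ⁻¹)          ≈⟨ sym (assoc _ _ _) ⟩
      g ∙ x ⁻¹ ∙ g ⁻¹ ∎)

    conj-ε : ∀ g → conj g ε ≈ ε
    conj-ε g = trans (∙-cong (identityʳ g) refl) (inverseʳ g)

    conj-comm : ∀ g x y → conj g [ x , y ] ≈ [ conj g x , conj g y ]
    conj-comm g x y = begin
      conj g (x ⁻¹ ∙ y ⁻¹ ∙ x ∙ y)
        ≈⟨ conj-∙ g _ y ⟩
      conj g (x ⁻¹ ∙ y ⁻¹ ∙ x) ∙ conj g y
        ≈⟨ ∙-cong (conj-∙ g _ x) refl ⟩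
      conj g (x ⁻¹ ∙ y ⁻¹) ∙ conj g x ∙ conj g y
        ≈⟨ ∙-cong (∙-cong (conj-∙ g _ _) refl) refl ⟩
      conj g (x ⁻¹) ∙ conj g (y ⁻¹) ∙ conj g x ∙ conj g y
        ≈⟨ ∙-cong (∙-cong (∙-cong (conj-⁻¹ g x) (conj-⁻¹ g y)) refl) refl ⟩
      [ conj g x , conj g y ] ∎

  ∩-subgroup : ∀ {H K} → IsSubgroup H → IsSubgroup K → IsSubgroup (H ∩ K)
  ∩-subgroup sH sK = record
    { resp = λ eq p → H.resp eq (proj₁ p) , K.resp eq (proj₂ p)
    ; ε∈   = H.ε∈ , K.ε∈
    ; ∙∈   = λ p q → H.∙∈ (proj₁ p) (proj₁ q) , K.∙∈ (proj₂ p) (proj₂ q)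
    ; ⁻¹∈  = λ p → H.⁻¹∈ (proj₁ p) , K.⁻¹∈ (proj₂ p)
    }
    where module H = IsSubgroup sH
          module K = IsSubgroup sK

  ∩-normal : ∀ {H K} → IsNormalSubgroup H → IsNormalSubgroup K → IsNormalSubgroup (H ∩ K)
  ∩-normal nH nK = record
    { isSubgroup = ∩-subgroup (IsNormalSubgroup.isSubgroup nH) (IsNormalSubgroup.isSubgroup nK)
    ; conj∈ = λ g p → IsNormalSubgroup.conj∈ nH g (proj₁ p) , IsNormalSubgroup.conj∈ nK g (proj₂ p)
    }

  comm-resp : ∀ {H x y} → x ≈ y → Commutator H x → Commutator H y
  comm-resp eq (gen a b ha hb e) = gen a b ha hb (trans (sym eq) e)
  comm-resp eq (one e)           = one (trans (sym eq) e)
  comm-resp eq (mul a b p q e)   = mul a b p q (trans (sym eq) e)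
  comm-resp eq (inv a p e)       = inv a p (trans (sym eq) e)

  comm-subgroup : ∀ H → IsSubgroup (Commutator H)
  comm-subgroup H = record
    { resp = comm-resp
    ; ε∈   = one refl
    ; ∙∈   = λ p q → mul _ _ p q refl
    ; ⁻¹∈  = λ p → inv _ p refl
    }

  comm-⊆ : ∀ {H} → IsSubgroup H → Commutator H ⊆ H
  comm-⊆ sH (gen a b ha hb e) = resp (sym e) (∙∈ (∙∈ (∙∈ (⁻¹∈ ha) (⁻¹∈ hb)) ha) hb)
    where open IsSubgroup sH
  comm-⊆ sH (one e)           = IsSubgroup.resp sH (sym e) (IsSubgroup.ε∈ sH)
  comm-⊆ sH (mul a b p q e)   = IsSubgroup.resp sH (sym e) (IsSubgroup.∙∈ sH (comm-⊆ sH p) (comm-⊆ sH q))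
  comm-⊆ sH (inv a p e)       = IsSubgroup.resp sH (sym e) (IsSubgroup.⁻¹∈ sH (comm-⊆ sH p))

  comm-conj : ∀ {H} → IsNormalSubgroup H → ∀ g {x} → Commutator H x → Commutator H (conj g x)
  comm-conj nH g (gen a b ha hb e) =
    gen (conj g a) (conj g b) (IsNormalSubgroup.conj∈ nH g ha) (IsNormalSubgroup.conj∈ nH g hb)
        (trans (conj-cong g e) (conj-comm g a b))
  comm-conj nH g (one e)         = one (trans (conj-cong g e) (conj-ε g))
  comm-conj nH g (mul a b p q e) =
    mul (conj g a) (conj g b) (comm-conj nH g p) (comm-conj nH g q) (trans (conj-cong g e) (conj-∙ g a b))
  comm-conj nH g (inv a p e)     =
    inv (conj g a) (comm-conj nH g p) (trans (conj-cong g e) (conj-⁻¹ g a))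

  comm-normal : ∀ {H} → IsNormalSubgroup H → IsNormalSubgroup (Commutator H)
  comm-normal {H} nH = record { isSubgroup = comm-subgroup H ; conj∈ = comm-conj nH }

  ·-subgroup : ∀ {H K} → IsSubgroup H → IsNormalSubgroup K → IsSubgroup (H · K)
  ·-subgroup {H} {K} sH nK = record
    { resp = λ { eq (h , k , ph , pk , e) → h , k , ph , pk , trans (sym eq) e }
    ; ε∈   = ε , ε , H.ε∈ , K.ε∈ , sym (identityˡ ε)
    ; ∙∈   = mul∈
    ; ⁻¹∈  = inv∈
    }
    where
      module H = IsSubgroup sH
      module K = IsNormalSubgroup nK

      key : ∀ h k → h ∙ conj (h ⁻¹) k ≈ k ∙ h
      key h k = begin
        h ∙ (h ⁻¹ ∙ k ∙ h ⁻¹ ⁻¹)  ≈⟨ ∙-cong refl (∙-cong refl (⁻¹-involutive h)) ⟩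
        h ∙ (h ⁻¹ ∙ k ∙ h)        ≈⟨ sym (assoc _ _ _) ⟩
        h ∙ (h ⁻¹ ∙ k) ∙ h        ≈⟨ ∙-cong (cancelˡ h k) refl ⟩
        k ∙ h ∎

      mul∈ : ∀ {x y} → (H · K) x → (H · K) y → (H · K) (x ∙ y)
      mul∈ {x} {y} (h₁ , k₁ , ph₁ , pk₁ , e₁) (h₂ , k₂ , ph₂ , pk₂ , e₂) =
        h₁ ∙ h₂ , conj (h₂ ⁻¹) k₁ ∙ k₂ , H.∙∈ ph₁ ph₂ , K.∙∈ (K.conj∈ (h₂ ⁻¹) pk₁) pk₂ ,
        (begin
          x ∙ y                                  ≈⟨ ∙-cong e₁ e₂ ⟩
          h₁ ∙ k₁ ∙ (h₂ ∙ k₂)                    ≈⟨ assoc _ _ _ ⟩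
          h₁ ∙ (k₁ ∙ (h₂ ∙ k₂))                  ≈⟨ ∙-cong refl (sym (assoc _ _ _)) ⟩
          h₁ ∙ (k₁ ∙ h₂ ∙ k₂)                    ≈⟨ ∙-cong refl (∙-cong (sym (key h₂ k₁)) refl) ⟩
          h₁ ∙ (h₂ ∙ conj (h₂ ⁻¹) k₁ ∙ k₂)       ≈⟨ ∙-cong refl (assoc _ _ _) ⟩
          h₁ ∙ (h₂ ∙ (conj (h₂ ⁻¹) k₁ ∙ k₂))     ≈⟨ sym (assoc _ _ _) ⟩
          h₁ ∙ h₂ ∙ (conj (h₂ ⁻¹) k₁ ∙ k₂) ∎)

      inv∈ : ∀ {x} → (H · K) x → (H · K) (x ⁻¹)
      inv∈ {x} (h , k , ph , pk , e) =
        h ⁻¹ , conj h (k ⁻¹) , H.⁻¹∈ ph , K.conj∈ h (K.⁻¹∈ pk) ,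
        (begin
          x ⁻¹                          ≈⟨ ⁻¹-cong e ⟩
          (h ∙ k) ⁻¹                    ≈⟨ ⁻¹-anti-homo-∙ h k ⟩
          k ⁻¹ ∙ h ⁻¹                   ≈⟨ ∙-cong (sym (cancelˡ' h (k ⁻¹))) refl ⟩
          h ⁻¹ ∙ (h ∙ k ⁻¹) ∙ h ⁻¹      ≈⟨ assoc _ _ _ ⟩
          h ⁻¹ ∙ (h ∙ k ⁻¹ ∙ h ⁻¹) ∎)

  module Setup (A B C : Subset)
               (nA : IsNormalSubgroup A) (nB : IsNormalSubgroup B) (nC : IsNormalSubgroup C)
               (B⊆A : B ⊆ A) where

    A' : Subset
    A' = Commutator A

    private
      sA = IsNormalSubgroup.isSubgroup nA
      sB = IsNormalSubgroup.isSubgroup nB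
      sC = IsNormalSubgroup.isSubgroup nC
      nA' = comm-normal nA
      A'⊆A : A' ⊆ A
      A'⊆A = comm-⊆ sA
      module A = IsSubgroup sA
      module C = IsSubgroup sC

    N₁ M₁ Q₁ BA' : Subset
    N₁  = (B ∩ C) · (C ∩ A')
    M₁  = A ∩ C
    Q₁  = (A ∩ C) · A'
    BA' = B · A'

    private
      sN₁ = ·-subgroup (∩-subgroup sB sC) (∩-normal nC nA')
      sM₁ = ∩-subgroup sA sC
      sQ₁ = ·-subgroup sM₁ nA'
      sBA' = ·-subgroup sB nA'

    𝑁₁ 𝑀₁ 𝑄₁ 𝑁₂ 𝑀₂ 𝑄₂ : RawGroup (c ⊔ ℓ) (c ⊔ ℓ)
    𝑁₁ = Quot N₁ sN₁ (B ∩ C)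
    𝑀₁ = Quot M₁ sM₁ (B ∩ C)
    𝑄₁ = Quot Q₁ sQ₁ ((B ∩ C) · A')
    𝑁₂ = Quot BA' sBA' B
    𝑀₂ = Quot A sA B
    𝑄₂ = Quot A sA BA'

    private
      C𝑁₁ = RawGroup.Carrier 𝑁₁
      C𝑀₁ = RawGroup.Carrier 𝑀₁
      C𝑄₁ = RawGroup.Carrier 𝑄₁
      C𝑁₂ = RawGroup.Carrier 𝑁₂
      C𝑀₂ = RawGroup.Carrier 𝑀₂
      C𝑄₂ = RawGroup.Carrier 𝑄₂

    -- all maps send the coset of a representative x to the coset of x

    ι₁ : C𝑁₁ → C𝑀₁
    ι₁ (x , (b , k , (b∈B , b∈C) , (k∈C , k∈A') , e)) =
      x , A.resp (sym e) (A.∙∈ (B⊆A b∈B) (A'⊆A k∈A')) , C.resp (sym e) (C.∙∈ b∈C k∈C)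

    π₁ : C𝑀₁ → C𝑄₁
    π₁ (x , p) = x , (x , ε , p , one refl , sym (identityʳ x))

    ι₂ : C𝑁₂ → C𝑀₂
    ι₂ (x , (b , k , b∈B , k∈A' , e)) = x , A.resp (sym e) (A.∙∈ (B⊆A b∈B) (A'⊆A k∈A'))

    π₂ : C𝑀₂ → C𝑄₂
    π₂ (x , p) = x , p

    f₁ : C𝑁₁ → C𝑁₂
    f₁ (x , (b , k , (b∈B , b∈C) , (k∈C , k∈A') , e)) = x , (b , k , b∈B , k∈A' , e)

    f₂ : C𝑀₁ → C𝑀₂
    f₂ (x , p) = x , proj₁ p

    f₃ : C𝑄₁ → C𝑄₂
    f₃ (x , (h , k , h∈AC , k∈A' , e)) = x , A.resp (sym e) (A.∙∈ (proj₁ h∈AC) (A'⊆A k∈A'))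

{-# OPTIONS --safe #-}
-- Every map in the diagram sends the class of a representative to the class of
-- the same element, so each algebraic statement reduces to an inclusion between
-- subgroups, and these follow from the Dedekind modular law and the fact that
-- products with a normal subgroup commute. The one substantial point is (3):
-- surjectivity of f₂ says A = (A ∩ C)B, so every commutator of A is congruent
-- modulo B to a commutator of A ∩ C, whence A' ⊆ B(C ∩ A'); this inclusion makes
-- f₁ surjective and f₃ injective.
module Submission where

open import Defs
open import Level using (_⊔_)
open import Data.Product using (Σ; _×_; _,_; proj₁; proj₂)
open import Relation.Unary using (Pred; _⊆_; _∩_)
open import Function.Base using (id)
open import Algebra.Bundles using (Group; RawGroup)
open import Algebra.Morphism.Structures using (module GroupMorphisms)
open import Function.Definitions using (Injective; Surjective)
import Relation.Binary.Reasoning.Setoid as SetoidReasoning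
import Algebra.Properties.Group as GroupProperties

module SubgroupProperties {c ℓ} (G : Group c ℓ) where
  open Group G
  open GroupProperties G
  open GroupTheory G
  open SetoidReasoning setoid

  H⊆H·K : ∀ {H K} → IsSubgroup K → H ⊆ (H · K)
  H⊆H·K sK {x} x∈H = x , ε , x∈H , IsSubgroup.ε∈ sK , sym (identityʳ x)

  K⊆H·K : ∀ {H K} → IsSubgroup H → K ⊆ (H · K)
  K⊆H·K sH {x} x∈K = ε , x , IsSubgroup.ε∈ sH , x∈K , sym (identityˡ x)

  ·-mono : ∀ {H H' K K'} → H ⊆ H' → K ⊆ K' → (H · K) ⊆ (H' · K')
  ·-mono H⊆H' K⊆K' (h , k , h∈H , k∈K , x≈hk) = h , k , H⊆H' h∈H , K⊆K' k∈K , x≈hk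

  ·-least : ∀ {D H K} → IsSubgroup D → H ⊆ D → K ⊆ D → (H · K) ⊆ D
  ·-least sD H⊆D K⊆D (h , k , h∈H , k∈K , x≈hk) =
    IsSubgroup.resp sD (sym x≈hk) (IsSubgroup.∙∈ sD (H⊆D h∈H) (K⊆D k∈K))

  N·H⊆H·N : ∀ {N H} → IsNormalSubgroup N → (N · H) ⊆ (H · N)
  N·H⊆H·N nN {x} (n , h , n∈N , h∈H , x≈nh) =
    h , conj (h ⁻¹) n , h∈H , IsNormalSubgroup.conj∈ nN (h ⁻¹) n∈N , (begin
      x                            ≈⟨ x≈nh ⟩
      n ∙ h                        ≈⟨ \\-leftDividesˡ h (n ∙ h) ⟨
      h ∙ (h ⁻¹ ∙ (n ∙ h))         ≈⟨ ∙-congˡ (assoc _ _ _) ⟨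
      h ∙ (h ⁻¹ ∙ n ∙ h)           ≈⟨ ∙-congˡ (∙-congˡ (⁻¹-involutive h)) ⟨
      h ∙ (h ⁻¹ ∙ n ∙ h ⁻¹ ⁻¹)     ∎)

  H·N⊆N·H : ∀ {N H} → IsNormalSubgroup N → (H · N) ⊆ (N · H)
  H·N⊆N·H nN {x} (h , n , h∈H , n∈N , x≈hn) =
    conj h n , h , IsNormalSubgroup.conj∈ nN h n∈N , h∈H ,
    trans x≈hn (sym (//-rightDividesˡ h (h ∙ n)))

  dedekindˡ : ∀ {C H K} → IsSubgroup C → H ⊆ C → (C ∩ (H · K)) ⊆ (H · (C ∩ K))
  dedekindˡ {C} sC H⊆C {x} (x∈C , h , k , h∈H , k∈K , x≈hk) =
    h , k , h∈H , (k∈C , k∈K) , x≈hk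
    where
      k∈C : C k
      k∈C = IsSubgroup.resp sC (sym (y≈x\\z h k x (sym x≈hk)))
                                 (IsSubgroup.∙∈ sC (IsSubgroup.⁻¹∈ sC (H⊆C h∈H)) x∈C)

  dedekindʳ : ∀ {C H K} → IsSubgroup C → K ⊆ C → (C ∩ (H · K)) ⊆ ((H ∩ C) · K)
  dedekindʳ {C} sC K⊆C {x} (x∈C , h , k , h∈H , k∈K , x≈hk) =
    h , k , (h∈H , h∈C) , k∈K , x≈hk
    where
      h∈C : C h
      h∈C = IsSubgroup.resp sC (sym (x≈z//y h k x (sym x≈hk)))
                                 (IsSubgroup.∙∈ sC x∈C (IsSubgroup.⁻¹∈ sC (K⊆C k∈K)))

  module CosetEquality {K : Subset} (sK : IsSubgroup K) where
    open IsSubgroup sK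

    _∼_ : Carrier → Carrier → Set (c ⊔ ℓ)
    x ∼ y = K (x ⁻¹ ∙ y)

    ∼-reflexive : ∀ {x y} → x ≈ y → x ∼ y
    ∼-reflexive {x} x≈y = resp (sym (trans (∙-congˡ (sym x≈y)) (inverseˡ x))) ε∈

    ∼-trans : ∀ {x y z} → x ∼ y → y ∼ z → x ∼ z
    ∼-trans {x} {y} {z} x∼y y∼z =
      resp (trans (assoc _ _ _) (∙-congˡ (\\-leftDividesˡ y z))) (∙∈ x∼y y∼z)

    ≈∙⇒∼ : ∀ {x y k} → x ≈ y ∙ k → K k → y ∼ x
    ≈∙⇒∼ {x} {y} {k} x≈yk k∈K = resp (y≈x\\z y k x (sym x≈yk)) k∈K

    ∈⇒∼ε : ∀ {x} → K x → x ∼ ε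
    ∈⇒∼ε x∈K = resp (sym (identityʳ _)) (⁻¹∈ x∈K)

    ∼ε⇒∈ : ∀ {x} → x ∼ ε → K x
    ∼ε⇒∈ {x} x∼ε = resp (⁻¹-involutive x) (⁻¹∈ (resp (identityʳ _) x∼ε))

  module NormalCongruence {N : Subset} (nN : IsNormalSubgroup N) where
    open IsNormalSubgroup nN
    open CosetEquality isSubgroup

    ∼-∙-cong : ∀ {x x' y y'} → x ∼ x' → y ∼ y' → (x ∙ y) ∼ (x' ∙ y')
    ∼-∙-cong {x} {x'} {y} {y'} x∼x' y∼y' = resp eq (∙∈ (conj∈ (y ⁻¹) x∼x') y∼y')
      where
        eq : conj (y ⁻¹) (x ⁻¹ ∙ x') ∙ (y ⁻¹ ∙ y') ≈ (x ∙ y) ⁻¹ ∙ (x' ∙ y')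
        eq = begin
          y ⁻¹ ∙ (x ⁻¹ ∙ x') ∙ y ⁻¹ ⁻¹ ∙ (y ⁻¹ ∙ y')  ≈⟨ ∙-congʳ (∙-congˡ (⁻¹-involutive y)) ⟩
          y ⁻¹ ∙ (x ⁻¹ ∙ x') ∙ y ∙ (y ⁻¹ ∙ y')        ≈⟨ assoc _ _ _ ⟩
          y ⁻¹ ∙ (x ⁻¹ ∙ x') ∙ (y ∙ (y ⁻¹ ∙ y'))      ≈⟨ ∙-congˡ (\\-leftDividesˡ y y') ⟩
          y ⁻¹ ∙ (x ⁻¹ ∙ x') ∙ y'                     ≈⟨ ∙-congʳ (assoc _ _ _) ⟨
          y ⁻¹ ∙ x ⁻¹ ∙ x' ∙ y'                       ≈⟨ assoc _ _ _ ⟩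
          y ⁻¹ ∙ x ⁻¹ ∙ (x' ∙ y')                     ≈⟨ ∙-congʳ (⁻¹-anti-homo-∙ x y) ⟨
          (x ∙ y) ⁻¹ ∙ (x' ∙ y')                      ∎

    ∼-⁻¹-cong : ∀ {x x'} → x ∼ x' → (x ⁻¹) ∼ (x' ⁻¹)
    ∼-⁻¹-cong {x} {x'} x∼x' = resp eq (conj∈ x (⁻¹∈ x∼x'))
      where
        eq : conj x ((x ⁻¹ ∙ x') ⁻¹) ≈ x ⁻¹ ⁻¹ ∙ x' ⁻¹
        eq = begin
          x ∙ (x ⁻¹ ∙ x') ⁻¹ ∙ x ⁻¹      ≈⟨ ∙-congʳ (∙-congˡ (⁻¹-anti-homo-∙ _ _)) ⟩
          x ∙ (x' ⁻¹ ∙ x ⁻¹ ⁻¹) ∙ x ⁻¹   ≈⟨ ∙-congʳ (∙-congˡ (∙-congˡ (⁻¹-involutive x))) ⟩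
          x ∙ (x' ⁻¹ ∙ x) ∙ x ⁻¹         ≈⟨ ∙-congʳ (assoc _ _ _) ⟨
          x ∙ x' ⁻¹ ∙ x ∙ x ⁻¹           ≈⟨ //-rightDividesʳ x (x ∙ x' ⁻¹) ⟩
          x ∙ x' ⁻¹                      ≈⟨ ∙-congʳ (⁻¹-involutive x) ⟨
          x ⁻¹ ⁻¹ ∙ x' ⁻¹                ∎

    ∼-[,]-cong : ∀ {x x' y y'} → x ∼ x' → y ∼ y' → [ x , y ] ∼ [ x' , y' ]
    ∼-[,]-cong x∼x' y∼y' =
      ∼-∙-cong (∼-∙-cong (∼-∙-cong (∼-⁻¹-cong x∼x') (∼-⁻¹-cong y∼y')) x∼x') y∼y'

  module RepresentativeMap {H₁ K₁ H₂ K₂ : Subset}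
           (sH₁ : IsSubgroup H₁) (sK₁ : IsSubgroup K₁)
           (sH₂ : IsSubgroup H₂) (sK₂ : IsSubgroup K₂) (K₁⊆K₂ : K₁ ⊆ K₂)
           (f : Σ Carrier H₁ → Σ Carrier H₂) (f-rep : ∀ x → proj₁ (f x) ≈ proj₁ x) where
    private
      Q₁ = Quot H₁ sH₁ K₁
      Q₂ = Quot H₂ sH₂ K₂
      module K₂ = IsSubgroup sK₂
      open RawGroup Q₁ using () renaming (_≈_ to _≈₁_)
      open RawGroup Q₂ using () renaming (_≈_ to _≈₂_)
    open CosetEquality sK₂

    isGroupHomomorphism : GroupMorphisms.IsGroupHomomorphism Q₁ Q₂ f
    isGroupHomomorphism = record
      { isMonoidHomomorphism = record
        { isMagmaHomomorphism = record
          { isRelHomomorphism = record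
            { cong = λ {x} {y} x∼y →
                K₂.resp (∙-cong (⁻¹-cong (sym (f-rep x))) (sym (f-rep y))) (K₁⊆K₂ x∼y) }
          ; homo = λ x y → ∼-reflexive (trans (f-rep _) (∙-cong (sym (f-rep x)) (sym (f-rep y))))
          }
        ; ε-homo = ∼-reflexive (f-rep _)
        }
      ; ⁻¹-homo = λ x → ∼-reflexive (trans (f-rep _) (⁻¹-cong (sym (f-rep x))))
      }

    injective : (H₁ ∩ K₂) ⊆ K₁ → Injective _≈₁_ _≈₂_ f
    injective H₁∩K₂⊆K₁ {x} {y} fx∼fy =
      H₁∩K₂⊆K₁ ( IsSubgroup.∙∈ sH₁ (IsSubgroup.⁻¹∈ sH₁ (proj₂ x)) (proj₂ y)
               , K₂.resp (∙-cong (⁻¹-cong (f-rep x)) (f-rep y)) fx∼fy)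

    surjective : H₂ ⊆ (H₁ · K₂) → Surjective _≈₁_ _≈₂_ f
    surjective H₂⊆H₁·K₂ (y , y∈H₂) with H₂⊆H₁·K₂ y∈H₂
    ... | h , k , h∈H₁ , k∈K₂ , y≈hk =
      (h , h∈H₁) , λ {z} z∼h →
        K₂.resp (∙-congʳ (⁻¹-cong (sym (f-rep z)))) (∼-trans (K₁⊆K₂ z∼h) (≈∙⇒∼ y≈hk k∈K₂))

    surjective⇒⊆· : Surjective _≈₁_ _≈₂_ f → H₂ ⊆ (H₁ · K₂)
    surjective⇒⊆· surj {y} y∈H₂ with surj (y , y∈H₂)
    ... | (x , x∈H₁) , f⁻¹[y] =
      x , x ⁻¹ ∙ y , x∈H₁ ,
      K₂.resp (∙-congʳ (⁻¹-cong (f-rep (x , x∈H₁))))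
              (f⁻¹[y] {x , x∈H₁} (CosetEquality.∼-reflexive sK₁ refl)) ,
      sym (\\-leftDividesˡ x y)

    isGroupMonomorphism : (H₁ ∩ K₂) ⊆ K₁ → GroupMorphisms.IsGroupMonomorphism Q₁ Q₂ f
    isGroupMonomorphism H₁∩K₂⊆K₁ = record
      { isGroupHomomorphism = isGroupHomomorphism ; injective = injective H₁∩K₂⊆K₁ }

    isGroupIsomorphism : (H₁ ∩ K₂) ⊆ K₁ → H₂ ⊆ (H₁ · K₂) →
                         GroupMorphisms.IsGroupIsomorphism Q₁ Q₂ f
    isGroupIsomorphism H₁∩K₂⊆K₁ H₂⊆H₁·K₂ = record
      { isGroupMonomorphism = isGroupMonomorphism H₁∩K₂⊆K₁
      ; surjective          = surjective H₂⊆H₁·K₂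
      }

  representative-shortExact :
    ∀ {N M Q K L : Subset}
    (sN : IsSubgroup N) (sM : IsSubgroup M) (sQ : IsSubgroup Q)
    (sK : IsSubgroup K) (sL : IsSubgroup L) (K⊆L : K ⊆ L)
    {ι : Σ Carrier N → Σ Carrier M} (ι-rep : ∀ x → proj₁ (ι x) ≈ proj₁ x)
    {π : Σ Carrier M → Σ Carrier Q} (π-rep : ∀ x → proj₁ (π x) ≈ proj₁ x) →
    N ⊆ L → (M ∩ L) ⊆ N → Q ⊆ (M · L) →
    ShortExact (Quot N sN K) (Quot M sM K) (Quot Q sQ L) ι π
  representative-shortExact sN sM sQ sK sL K⊆L {ι} ι-rep {π} π-rep N⊆L M∩L⊆N Q⊆M·L = record
    { ι-hom        = ιMap.isGroupHomomorphism
    ; π-hom        = πMap.isGroupHomomorphism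
    ; ι-injective  = ιMap.injective proj₂
    ; π-surjective = πMap.surjective Q⊆M·L
    ; im⊆ker       = λ n → L.∈⇒∼ε (IsSubgroup.resp sL (sym (πι-rep n)) (N⊆L (proj₂ n)))
    ; ker⊆im       = λ m πm∼ε →
        (proj₁ m , M∩L⊆N (proj₂ m , IsSubgroup.resp sL (π-rep m) (L.∼ε⇒∈ πm∼ε)))
        , K.∼-reflexive (ι-rep _)
    }
    where
      module ιMap = RepresentativeMap sN sK sM sK id ι ι-rep
      module πMap = RepresentativeMap sM sK sQ sL K⊆L π π-rep
      module K = CosetEquality sK
      module L = CosetEquality sL
      πι-rep : ∀ n → proj₁ (π (ι n)) ≈ proj₁ n
      πι-rep n = trans (π-rep (ι n)) (ι-rep n)

module Lemma2p6 {c ℓ} (G : Group c ℓ) (A B C : Pred (Group.Carrier G) (c ⊔ ℓ))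
                (nA : GroupTheory.IsNormalSubgroup G A) (nB : GroupTheory.IsNormalSubgroup G B)
                (nC : GroupTheory.IsNormalSubgroup G C) (B⊆A : B ⊆ A) where
  open Group G
  open GroupProperties G using (\\-leftDividesˡ; x≈z//y)
  open GroupTheory G
  open Setup A B C nA nB nC B⊆A
  open SubgroupProperties G

  private
    sA    = IsNormalSubgroup.isSubgroup nA
    sB    = IsNormalSubgroup.isSubgroup nB
    sC    = IsNormalSubgroup.isSubgroup nC
    sA'   = comm-subgroup A
    nA'   = comm-normal nA
    sBC   = ∩-subgroup sB sC
    sCA'  = ∩-subgroup sC sA'
    sN₁   = ·-subgroup sBC (∩-normal nC nA')
    sM₁   = ∩-subgroup sA sC
    sQ₁   = ·-subgroup sM₁ nA'
    sBA'  = ·-subgroup sB nA'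
    sBCA' = ·-subgroup sBC nA'
    sD    = ·-subgroup sB (∩-normal nC nA')
    module A'   = IsSubgroup sA'
    module D    = IsSubgroup sD
    module BA'  = IsSubgroup sBA'
    module BCA' = IsSubgroup sBCA'

  N₁⊆C : N₁ ⊆ C
  N₁⊆C = ·-least sC proj₂ proj₁

  N₁⊆[B∩C]·A' : N₁ ⊆ ((B ∩ C) · A')
  N₁⊆[B∩C]·A' = ·-mono id proj₂

  M₁∩[B∩C]·A'⊆N₁ : (M₁ ∩ ((B ∩ C) · A')) ⊆ N₁
  M₁∩[B∩C]·A'⊆N₁ ((_ , x∈C) , x∈[B∩C]·A') = dedekindˡ sC proj₂ (x∈C , x∈[B∩C]·A')

  top-shortExact : ShortExact 𝑁₁ 𝑀₁ 𝑄₁ ι₁ π₁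
  top-shortExact =
    representative-shortExact sN₁ sM₁ sQ₁ sBC sBCA' (H⊆H·K sA') (λ _ → refl) (λ _ → refl)
      N₁⊆[B∩C]·A' M₁∩[B∩C]·A'⊆N₁ (·-mono id (K⊆H·K sBC))

  bottom-shortExact : ShortExact 𝑁₂ 𝑀₂ 𝑄₂ ι₂ π₂
  bottom-shortExact =
    representative-shortExact sBA' sA sA sB sBA' (H⊆H·K sA') (λ _ → refl) (λ _ → refl)
      id proj₂ (H⊆H·K sBA')

  module F₁ = RepresentativeMap sN₁ sBC sBA' sB proj₁ f₁ (λ _ → refl)
  module F₂ = RepresentativeMap sM₁ sBC sA sB proj₁ f₂ (λ _ → refl)
  module F₃ = RepresentativeMap sQ₁ sBCA' sA sBA' (·-mono proj₁ id) f₃ (λ _ → refl)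

  N₁∩B⊆B∩C : (N₁ ∩ B) ⊆ (B ∩ C)
  N₁∩B⊆B∩C (x∈N₁ , x∈B) = x∈B , N₁⊆C x∈N₁

  M₁∩B⊆B∩C : (M₁ ∩ B) ⊆ (B ∩ C)
  M₁∩B⊆B∩C ((_ , x∈C) , x∈B) = x∈B , x∈C

  left-square : Commutes 𝑀₂ ι₁ f₁ f₂ ι₂
  left-square _ = CosetEquality.∼-reflexive sB refl

  right-square : Commutes 𝑄₂ π₁ f₂ f₃ π₂
  right-square _ = CosetEquality.∼-reflexive sBA' refl

  module _ (A⊆[A∩C]·B : A ⊆ ((A ∩ C) · B)) where
    open CosetEquality sB using (≈∙⇒∼)
    open NormalCongruence nB using (∼-[,]-cong)

    -- A generator [x, y] of A' is congruent modulo B to [a, a'] ∈ C ∩ A', where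
    -- a, a' ∈ A ∩ C represent x, y modulo B.
    A'⊆B·[C∩A'] : A' ⊆ (B · (C ∩ A'))
    A'⊆B·[C∩A'] (one z≈ε)           = D.resp (sym z≈ε) D.ε∈
    A'⊆B·[C∩A'] (mul _ _ p q z≈xy)  = D.resp (sym z≈xy) (D.∙∈ (A'⊆B·[C∩A'] p) (A'⊆B·[C∩A'] q))
    A'⊆B·[C∩A'] (inv _ p z≈x⁻¹)     = D.resp (sym z≈x⁻¹) (D.⁻¹∈ (A'⊆B·[C∩A'] p))
    A'⊆B·[C∩A'] {z} (gen x y x∈A y∈A z≈[x,y])
      with A⊆[A∩C]·B x∈A | A⊆[A∩C]·B y∈A
    ... | a , b , (a∈A , a∈C) , b∈B , x≈ab | a' , b' , (a'∈A , a'∈C) , b'∈B , y≈a'b' =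
      H·N⊆N·H nB
        ( [ a , a' ] , [ a , a' ] ⁻¹ ∙ [ x , y ]
        , (comm-⊆ sC (gen a a' a∈C a'∈C refl) , gen a a' a∈A a'∈A refl)
        , ∼-[,]-cong (≈∙⇒∼ x≈ab b∈B) (≈∙⇒∼ y≈a'b' b'∈B)
        , trans z≈[x,y] (sym (\\-leftDividesˡ [ a , a' ] [ x , y ])))

    BA'⊆B·[C∩A'] : BA' ⊆ (B · (C ∩ A'))
    BA'⊆B·[C∩A'] = ·-least sD (H⊆H·K sCA') A'⊆B·[C∩A']

    BA'⊆N₁·B : BA' ⊆ (N₁ · B)
    BA'⊆N₁·B x∈BA' = ·-mono (K⊆H·K sBC) id (N·H⊆H·N nB (BA'⊆B·[C∩A'] x∈BA'))

    Q₁∩BA'⊆[B∩C]·A' : (Q₁ ∩ BA') ⊆ ((B ∩ C) · A')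
    Q₁∩BA'⊆[B∩C]·A' {w} ((a , k , a∈M₁ , k∈A' , w≈ak) , w∈BA') =
      BCA'.resp (sym w≈ak) (BCA'.∙∈ a∈[B∩C]·A' (K⊆H·K sBC k∈A'))
      where
        a∈BA' : BA' a
        a∈BA' = BA'.resp (sym (x≈z//y a k w (sym w≈ak)))
                         (BA'.∙∈ w∈BA' (K⊆H·K sB (A'.⁻¹∈ k∈A')))
        a∈[B∩C]·A' : ((B ∩ C) · A') a
        a∈[B∩C]·A' = N₁⊆[B∩C]·A' (dedekindʳ sC proj₁
                       (proj₂ a∈M₁ , BA'⊆B·[C∩A'] a∈BA'))

    A⊆Q₁·BA' : A ⊆ (Q₁ · BA')
    A⊆Q₁·BA' x∈A = ·-mono (H⊆H·K sA') (H⊆H·K sA') (A⊆[A∩C]·B x∈A)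

lemma2p6 : ∀ {c ℓ} (G : Group c ℓ) (A B C : Pred (Group.Carrier G) (c ⊔ ℓ)) →
    (nA : GroupTheory.IsNormalSubgroup G A) → (nB : GroupTheory.IsNormalSubgroup G B) →
    (nC : GroupTheory.IsNormalSubgroup G C) → (B⊆A : B ⊆ A) →
    let open GroupTheory.Setup G A B C nA nB nC B⊆A in
    -- (1) the top sequence is short exact
    ShortExact 𝑁₁ 𝑀₁ 𝑄₁ ι₁ π₁
    -- (2) f₂ injective hom, f₁ injective (hom), f₃ hom, diagram to the canonical SES commutes
    × (GroupMorphisms.IsGroupMonomorphism 𝑀₁ 𝑀₂ f₂
       × GroupMorphisms.IsGroupMonomorphism 𝑁₁ 𝑁₂ f₁
       × GroupMorphisms.IsGroupHomomorphism 𝑄₁ 𝑄₂ f₃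
       × ShortExact 𝑁₂ 𝑀₂ 𝑄₂ ι₂ π₂
       × Commutes 𝑀₂ ι₁ f₁ f₂ ι₂
       × Commutes 𝑄₂ π₁ f₂ f₃ π₂)
    -- (3) if f₂ is an isomorphism, so are f₁, f₂, f₃ (isomorphism of SESs)
    × (GroupMorphisms.IsGroupIsomorphism 𝑀₁ 𝑀₂ f₂ →
         GroupMorphisms.IsGroupIsomorphism 𝑁₁ 𝑁₂ f₁
         × GroupMorphisms.IsGroupIsomorphism 𝑀₁ 𝑀₂ f₂
         × GroupMorphisms.IsGroupIsomorphism 𝑄₁ 𝑄₂ f₃)
lemma2p6 G A B C nA nB nC B⊆A =
    top-shortExact
  , ( F₂.isGroupMonomorphism M₁∩B⊆B∩C
    , F₁.isGroupMonomorphism N₁∩B⊆B∩C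
    , F₃.isGroupHomomorphism
    , bottom-shortExact
    , left-square
    , right-square )
  , λ f₂-iso →
      let A⊆[A∩C]·B = F₂.surjective⇒⊆· (GroupMorphisms.IsGroupIsomorphism.surjective f₂-iso) in
      F₁.isGroupIsomorphism N₁∩B⊆B∩C (BA'⊆N₁·B A⊆[A∩C]·B)
    , f₂-iso
    , F₃.isGroupIsomorphism (Q₁∩BA'⊆[B∩C]·A' A⊆[A∩C]·B) (A⊆Q₁·BA' A⊆[A∩C]·B)
  where open Lemma2p6 G A B C nA nB nC B⊆A
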